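{- Let $N = \{a,b,c,d,e,f,g\}$ be a set of seven distinct elements and let $G = \{\{a,b\}, \{a,d,c\}, \{a,e,f\}, \{b,e,c\}, \{b,g,f\}\}$. In the game in which Black and White alternately claim previously unclaimed elements of $N$, Black moving first, until all of $N$ is claimed, White has a strategy guaranteeing that every set in $G$ contains at least one element claimed by White.
   Context: This is the "BiTriangleX Configuration". The elements of $N$ are called markers, and the sets in $G$ are the traces on the markers of groups (possible winning lines) of a $k$-in-a-Row game. -}

module Defs where

open import Data.Fin using (Fin; _≟_)
open import Data.Fin.Patterns using (0F; 1F; 2F; 3F; 4F; 5F; 6F)
open import Data.List using (List; []; _∷_)
open import Data.List.Relation.Unary.All using (All)
open import Data.List.Relation.Unary.Any using (Any)
open import Data.Product using (Σ; _×_)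
open import Data.Sum using (_⊎_)
open import Relation.Binary.PropositionalEquality using (_≡_)
open import Relation.Nullary using (¬_; yes; no)

Marker : Set
Marker = Fin 7

a b c d e f g : Marker
a = 0F
b = 1F
c = 2F
d = 3F
e = 4F
f = 5F
g = 6F

G : List (List Marker)
G = (a ∷ b ∷ []) ∷ (a ∷ d ∷ c ∷ []) ∷ (a ∷ e ∷ f ∷ [])
  ∷ (b ∷ e ∷ c ∷ []) ∷ (b ∷ g ∷ f ∷ []) ∷ []

data Cell : Set where
  unclaimed black white : Cell

Board : Set
Board = Marker → Cell

initial : Board
initial _ = unclaimed

claim : Board → Marker → Cell → Board
claim p x col y with x ≟ y
... | yes _ = col
... | no  _ = p y

Unclaimed : Board → Marker → Set
Unclaimed p x = p x ≡ unclaimed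

Full : Board → Set
Full p = ∀ x → ¬ Unclaimed p x

WhiteGoal : Board → Set
WhiteGoal p = All (λ S → Any (λ x → p x ≡ white) S) G

-- Since these are inductive families over a finite game tree, an element
-- is exactly a (well-founded) winning strategy tree for White.
data WhiteWinsBlackToMove (p : Board) : Set
data WhiteWinsWhiteToMove (p : Board) : Set

data WhiteWinsBlackToMove p where
  finished : Full p → WhiteGoal p → WhiteWinsBlackToMove p
  blackMoves : ¬ Full p →
               (∀ x → Unclaimed p x → WhiteWinsWhiteToMove (claim p x black)) →
               WhiteWinsBlackToMove p

data WhiteWinsWhiteToMove p where
  finished : Full p → WhiteGoal p → WhiteWinsWhiteToMove p
  whiteMoves : (x : Marker) → Unclaimed p x →
               WhiteWinsBlackToMove (claim p x white) →
               WhiteWinsWhiteToMove p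

module Submission where

-- White's strategy is "answer the opening, then play a pairing strategy".
--
-- A pairing is an involution `mate` on the markers; y is paired when
-- y ≢ mate y.  White keeps two invariants while Black is to move:
--   * Covered: every group contains a White marker or a whole pair;
--   * Safe:    every pair contains a White marker or is wholly unclaimed.
-- When Black claims x, White claims mate x if it is still free, and any free
-- marker otherwise; both invariants survive such a round.  On a full board
-- Safe forces a White marker into every pair, so Covered gives White's goal.
-- Termination is by the number of free markers, which every claim lowers.
--
-- These finitely many opening positions are verified by evaluation.

open import Defs
open import Function using (_∘_)
open import Data.Fin using (_≟_)
open import Data.Fin.Patterns using (0F; 1F; 2F; 3F; 4F; 5F; 6F)
open import Data.Fin.Properties using (any?; all?)
open import Data.List using (List; []; _∷_; map; allFin)
open import Data.List.Membership.Propositional using (_∈_; find; lose)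
open import Data.List.Membership.Propositional.Properties using (∈-allFin)
open import Data.List.Membership.DecPropositional {A = Marker} _≟_ using (_∈?_)
open import Data.List.Relation.Unary.All as All using (All)
open import Data.List.Relation.Unary.Any as Any using (Any; here; there)
open import Data.Nat using (ℕ; suc; _≤_; _<_; z≤n; s≤s)
open import Data.Nat.ListAction using (sum)
open import Data.Nat.Properties
  using (≤-refl; +-mono-≤; +-mono-<-≤; +-mono-≤-<; <-trans; <-≤-trans; ≤-pred)
open import Data.Product using (_×_; _,_)
open import Data.Sum using (_⊎_; inj₁; inj₂)
import Data.Sum as Sum
open import Relation.Binary.PropositionalEquality using (_≡_; _≢_; refl; sym; trans; subst)
open import Algebra.Definitions (_≡_ {A = Marker}) using (Involutive)
open import Relation.Nullary using (Dec; yes; no; ¬_; ¬?; contradiction)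
open import Relation.Nullary.Decidable using (_×-dec_; _⊎-dec_; _→-dec_; toWitness)

unclaimed? : (col : Cell) → Dec (col ≡ unclaimed)
unclaimed? unclaimed = yes refl
unclaimed? black = no λ ()
unclaimed? white = no λ ()

white? : (col : Cell) → Dec (col ≡ white)
white? unclaimed = no λ ()
white? black = no λ ()
white? white = yes refl

full? : (p : Board) → Dec (Full p)
full? p = all? (λ x → ¬? (unclaimed? (p x)))

claim-self : ∀ p x col → claim p x col x ≡ col
claim-self p x col with x ≟ x
... | yes _ = refl
... | no x≢x = contradiction refl x≢x

claim-other : ∀ p x col {y} → x ≢ y → claim p x col y ≡ p y
claim-other p x col {y} x≢y with x ≟ y
... | yes x≡y = contradiction x≡y x≢y
... | no _ = refl

_⊑_ : Board → Board → Set
p ⊑ q = ∀ y → p y ≡ white → q y ≡ white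

claim-⊒ : ∀ p x col → Unclaimed p x → p ⊑ claim p x col
claim-⊒ p x col ux y wy with x ≟ y
... | yes refl = contradiction (trans (sym ux) wy) λ ()
... | no _ = wy

isFree : Cell → ℕ
isFree unclaimed = 1
isFree black = 0
isFree white = 0

freeCount : Board → ℕ
freeCount p = sum (map (isFree ∘ p) (allFin 7))

sum-map-≤ : ∀ {A : Set} {f g : A → ℕ} → (∀ y → f y ≤ g y) →
            ∀ xs → sum (map f xs) ≤ sum (map g xs)
sum-map-≤ f≤g [] = z≤n
sum-map-≤ f≤g (y ∷ ys) = +-mono-≤ (f≤g y) (sum-map-≤ f≤g ys)

sum-map-< : ∀ {A : Set} {f g : A → ℕ} {x xs} → (∀ y → f y ≤ g y) →
            x ∈ xs → f x < g x → sum (map f xs) < sum (map g xs)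
sum-map-< {xs = _ ∷ ys} f≤g (here refl) fx<gx = +-mono-<-≤ fx<gx (sum-map-≤ f≤g ys)
sum-map-< f≤g (there x∈ys) fx<gx = +-mono-≤-< (f≤g _) (sum-map-< f≤g x∈ys fx<gx)

claimed-not-free : ∀ {col} → col ≢ unclaimed → isFree col ≡ 0
claimed-not-free {unclaimed} claimed = contradiction refl claimed
claimed-not-free {black} _ = refl
claimed-not-free {white} _ = refl

claim-< : ∀ p x col → col ≢ unclaimed → Unclaimed p x →
          freeCount (claim p x col) < freeCount p
claim-< p x col claimed ux =
  sum-map-< pointwise (∈-allFin x)
    (subst (λ c → isFree c < isFree (p x)) (sym (claim-self p x col)) at-x)
  where
  at-x : isFree col < isFree (p x)
  at-x rewrite claimed-not-free claimed | ux = s≤s z≤n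

  pointwise : ∀ y → isFree (claim p x col y) ≤ isFree (p y)
  pointwise y with x ≟ y
  ... | yes refl rewrite claimed-not-free claimed = z≤n
  ... | no _ = ≤-refl

module Pairing (mate : Marker → Marker) where

  Paired : Marker → Set
  Paired y = y ≢ mate y

  -- The pair of y is safe in p: it already has a White marker, or both of
  -- its markers are still free (so White can answer inside it).
  SafeAt : Board → Marker → Set
  SafeAt p y = p y ≡ white ⊎ p (mate y) ≡ white ⊎ (Unclaimed p y × Unclaimed p (mate y))

  Safe : Board → Set
  Safe p = ∀ y → Paired y → SafeAt p y

  Blocked : Board → List Marker → Set
  Blocked p S = Any (λ y → p y ≡ white) S ⊎ Any (λ y → mate y ∈ S × Paired y) S

  Covered : Board → Set
  Covered p = All (Blocked p) G

  safe? : (p : Board) → Dec (Safe p)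
  safe? p = all? λ y → ¬? (y ≟ mate y) →-dec
    (white? (p y) ⊎-dec white? (p (mate y))
       ⊎-dec unclaimed? (p y) ×-dec unclaimed? (p (mate y)))

  covered? : (p : Board) → Dec (Covered p)
  covered? p = All.all? (λ S → Any.any? (λ y → white? (p y)) S
                          ⊎-dec Any.any? (λ y → (mate y ∈? S) ×-dec ¬? (y ≟ mate y)) S) G

  covered-mono : ∀ {p q} → p ⊑ q → Covered p → Covered q
  covered-mono p⊑q = All.map (Sum.map₁ (Any.map λ {y} → p⊑q y))

  -- On a full board a safe pair contains a White marker, so every blocked
  -- group does: the invariants imply White's goal.
  fullGoal : ∀ {p} → Full p → Safe p → Covered p → WhiteGoal p
  fullGoal {p} full safe = All.map hit
    where
    hit : ∀ {S} → Blocked p S → Any (λ y → p y ≡ white) S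
    hit (inj₁ w) = w
    hit (inj₂ pair) with find pair
    ... | y , y∈S , my∈S , paired with safe y paired
    ...   | inj₁ wy = lose y∈S wy
    ...   | inj₂ (inj₁ wmy) = lose my∈S wmy
    ...   | inj₂ (inj₂ (uy , _)) = contradiction uy (full y)

  safeAt-away : ∀ {p x y} col → Unclaimed p x → x ≢ y → x ≢ mate y →
                SafeAt p y → SafeAt (claim p x col) y
  safeAt-away {p} {x} {y} col ux _ _ (inj₁ wy) = inj₁ (claim-⊒ p x col ux y wy)
  safeAt-away {p} {x} {y} col ux _ _ (inj₂ (inj₁ wmy)) =
    inj₂ (inj₁ (claim-⊒ p x col ux (mate y) wmy))
  safeAt-away {p} {x} col _ x≢y x≢my (inj₂ (inj₂ (uy , umy))) =
    inj₂ (inj₂ (trans (claim-other p x col x≢y) uy , trans (claim-other p x col x≢my) umy))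

  safeAt-white : ∀ {r z y} → Unclaimed r z → SafeAt r y → SafeAt (claim r z white) y
  safeAt-white {r} {z} {y} uz s = byPosition (z ≟ y) (z ≟ mate y)
    where
    whiteAt : ∀ {w} → z ≡ w → claim r z white w ≡ white
    whiteAt refl = claim-self r z white

    byPosition : Dec (z ≡ y) → Dec (z ≡ mate y) → SafeAt (claim r z white) y
    byPosition (yes z≡y) _ = inj₁ (whiteAt z≡y)
    byPosition (no _) (yes z≡my) = inj₂ (inj₁ (whiteAt z≡my))
    byPosition (no z≢y) (no z≢my) = safeAt-away white uz z≢y z≢my s

  white-safe : ∀ {r z} → Safe r → Unclaimed r z → Safe (claim r z white)
  white-safe {r} {z} safe uz y paired = safeAt-white {r} {z} uz (safe y paired)

  -- The strategy itself needs `mate` to be an involution, so that pairs are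
  -- symmetric: the mate of mate y is y again.
  module Strategy (involutive : Involutive mate) where

    paired-mate : ∀ {y} → Paired y → Paired (mate y)
    paired-mate {y} paired eq = paired (trans (sym (involutive y)) (sym eq))

    safeAt-mate : ∀ {p y} → SafeAt p y → SafeAt p (mate y)
    safeAt-mate {p} {y} s rewrite involutive y with s
    ... | inj₁ wy = inj₂ (inj₁ wy)
    ... | inj₂ (inj₁ wmy) = inj₁ wmy
    ... | inj₂ (inj₂ (uy , umy)) = inj₂ (inj₂ (umy , uy))

    safe-around : ∀ {p q} x → Safe p →
                  (∀ {y} → x ≢ y → x ≢ mate y → SafeAt p y → SafeAt q y) →
                  (Paired x → SafeAt q x) → Safe q
    safe-around {p} {q} x safe away own y paired with x ≟ y | x ≟ mate y
    ... | yes refl | _ = own paired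
    ... | no _ | yes refl =
      subst (SafeAt q) (involutive y) (safeAt-mate {q} {mate y} (own (paired-mate paired)))
    ... | no x≢y | no x≢my = away x≢y x≢my (safe y paired)

    black-safe : ∀ {p x} → Safe p → Unclaimed p x →
                 ¬ Unclaimed (claim p x black) (mate x) → Safe (claim p x black)
    black-safe {p} {x} safe ux mateTaken = safe-around x safe (safeAt-away black ux) own
      where
      own : Paired x → SafeAt (claim p x black) x
      own paired with safe x paired
      ... | inj₁ wx = contradiction (trans (sym ux) wx) λ ()
      ... | inj₂ (inj₁ wmx) = inj₂ (inj₁ (claim-⊒ p x black ux (mate x) wmx))
      ... | inj₂ (inj₂ (_ , umx)) =
        contradiction (trans (claim-other p x black paired) umx) mateTaken

    reply-safe : ∀ {p x} → Safe p → Unclaimed p x → Unclaimed (claim p x black) (mate x) →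
                 Safe (claim (claim p x black) (mate x) white)
    reply-safe {p} {x} safe ux umx =
      safe-around x safe away λ _ → inj₂ (inj₁ (claim-self (claim p x black) (mate x) white))
      where
      away : ∀ {y} → x ≢ y → x ≢ mate y → SafeAt p y →
             SafeAt (claim (claim p x black) (mate x) white) y
      away x≢y x≢my s =
        safeAt-white {claim p x black} {mate x} umx (safeAt-away black ux x≢y x≢my s)

    pairingWins : ∀ n p → freeCount p < n → Covered p → Safe p → WhiteWinsBlackToMove p
    pairingWins (suc n) p fewer covered safe with full? p
    ... | yes full = finished full (fullGoal full safe covered)
    ... | no notFull = blackMoves notFull whiteReplies
      where
      continue : ∀ {x z} → Unclaimed p x → Unclaimed (claim p x black) z →
                 Safe (claim (claim p x black) z white) →
                 WhiteWinsBlackToMove (claim (claim p x black) z white)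
      continue {x} {z} ux uz safe′ =
        pairingWins n _ (<-trans (claim-< (claim p x black) z white (λ ()) uz)
                          (<-≤-trans (claim-< p x black (λ ()) ux) (≤-pred fewer)))
          (covered-mono (λ y → claim-⊒ (claim p x black) z white uz y ∘ claim-⊒ p x black ux y)
                        covered)
          safe′

      whiteReplies : ∀ x → Unclaimed p x → WhiteWinsWhiteToMove (claim p x black)
      whiteReplies x ux with unclaimed? (claim p x black (mate x))
      ... | yes umx = whiteMoves (mate x) umx (continue ux umx (reply-safe safe ux umx))
      ... | no mateTaken with any? (λ z → unclaimed? (claim p x black z))
      ...   | yes (z , uz) =
        whiteMoves z uz (continue ux uz (white-safe (black-safe safe ux mateTaken) uz))
      ...   | no noneFree = finished (λ z uz → noneFree (z , uz))
                (fullGoal (λ z uz → noneFree (z , uz)) (black-safe safe ux mateTaken)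
                          (covered-mono (claim-⊒ p x black ux) covered))

-- Swap the two markers of each listed pair (an involution when the pairs are
-- disjoint, which is checked for the concrete pairings below).
partner : List (Marker × Marker) → Marker → Marker
partner [] y = y
partner ((u , v) ∷ pairs) y with y ≟ u | y ≟ v
... | yes _ | _ = v
... | no _ | yes _ = u
... | no _ | no _ = partner pairs y

response : Marker → Marker
response 0F = b
response _ = a

-- The pairing White uses after each opening; it blocks every group that
-- the response leaves without a White marker.
pairsAfter : Marker → List (Marker × Marker)
pairsAfter 0F = (d , c) ∷ (e , f) ∷ []
pairsAfter 1F = (e , c) ∷ (g , f) ∷ []
pairsAfter 2F = (b , e) ∷ (g , f) ∷ []
pairsAfter 3F = (e , c) ∷ (g , f) ∷ []
pairsAfter 4F = (b , c) ∷ (g , f) ∷ []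
pairsAfter 5F = (e , c) ∷ (b , g) ∷ []
pairsAfter 6F = (e , c) ∷ (b , f) ∷ []

mateAfter : Marker → Marker → Marker
mateAfter x = partner (pairsAfter x)

afterOpening : Marker → Board
afterOpening x = claim (claim initial x black) (response x) white

OpeningSound : Marker → Set
OpeningSound x = Unclaimed (claim initial x black) (response x)
               × Involutive (mateAfter x)
               × Pairing.Covered (mateAfter x) (afterOpening x)
               × Pairing.Safe (mateAfter x) (afterOpening x)

openingSound : ∀ x → OpeningSound x
openingSound = toWitness {a? = all? λ x →
  unclaimed? (claim initial x black (response x))
  ×-dec all? (λ y → mateAfter x (mateAfter x y) ≟ y)
  ×-dec Pairing.covered? (mateAfter x) (afterOpening x)
  ×-dec Pairing.safe? (mateAfter x) (afterOpening x)} _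

mainTheorem5 : WhiteWinsBlackToMove initial
mainTheorem5 = blackMoves (λ full → full a refl) answer
  where
  answer : ∀ x → Unclaimed initial x → WhiteWinsWhiteToMove (claim initial x black)
  answer x ux with openingSound x
  ... | free , involutive , covered , safe =
    whiteMoves (response x) free
      (Pairing.Strategy.pairingWins (mateAfter x) involutive 7 (afterOpening x)
        (<-trans (claim-< (claim initial x black) (response x) white (λ ()) free)
                 (claim-< initial x black (λ ()) ux)) covered safe)
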